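{- Let $d\ge2$ and $\mathbf{x}=(x_1,\ldots,x_d)\in\mathbb{N}_0^d$. For a nonnegative integer $y$ let $\varphi(y)=\lfloor y/2\rfloor$ (the binary right shift) and $\xi(y)=(y_0+1)\bmod 2$, where $y_0$ is the last binary digit of $y$. Let $\alpha=\sum_{i=2}^{d}2^{d-i}\,\xi(x_i+1)$ (the number written in binary as $\xi(x_2+1)\cdots\xi(x_d+1)$). Then $\mathbf{x}\in\{\mathbf{r}(n):n\in\mathbb{N}\}$ if and only if $\varphi(x_i+1)=x_{i-1}$ for all $i\in\{2,\ldots,d\}$ and $\alpha(2^d-1)\equiv x_d-2^{d-1}\pmod{2^{d-1}(2^d-1)}$.
   Context: $\mathbb{N}=\{1,2,\ldots\}$, $\mathbb{N}_0=\mathbb{N}\cup\{0\}$. For $n\in\mathbb{N}$ and $i\in\{1,\ldots,d\}$, $r_i(n)=\left\lfloor \frac{(2^d-1)n}{2^{d-i}}\right\rfloor-2^{i-1}+1$ and $\mathbf{r}(n)=(r_1(n),\ldots,r_d(n))$. -}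

module Defs where

open import Data.Nat using (ℕ; zero; suc; _+_; _*_; _∸_; _^_; _≤_; s≤s; z≤n)
open import Data.Nat.DivMod using (_/_; _%_)
open import Data.Nat.Properties using (m^n≢0)
open import Data.Fin using (Fin; toℕ; fromℕ)
import Data.Fin as F
open import Data.List using (List; map; allFin)
open import Data.Nat.ListAction using (sum)
open import Data.Integer as ℤ using (ℤ; +_)

φ : ℕ → ℕ
φ y = y / 2

ξ : ℕ → ℕ
ξ y = ((y % 2) + 1) % 2

_/2^_ : ℕ → ℕ → ℕ
m /2^ k = _/_ m (2 ^ k) {{m^n≢0 2 k}}

-- Coordinates are indexed by i : Fin d, where i stands for the paper's index toℕ i + 1.
-- r_i(n) = ⌊(2^d - 1) n / 2^(d-i)⌋ - 2^(i-1) + 1   (computed in ℤ)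
r : (d : ℕ) → ℕ → Fin d → ℤ
r d n i = (+ (((2 ^ d ∸ 1) * n) /2^ (d ∸ suc (toℕ i))) ℤ.- + (2 ^ toℕ i)) ℤ.+ + 1

-- term of α for paper index i = toℕ j + 1; zero for paper index 1 (not in the sum)
αterm : (d : ℕ) → (Fin d → ℕ) → Fin d → ℕ
αterm d x F.zero = 0
αterm d x (F.suc j) = 2 ^ (d ∸ suc (toℕ (F.suc j))) * ξ (x (F.suc j) + 1)

α : (d : ℕ) → (Fin d → ℕ) → ℕ
α d x = sum (map (αterm d x) (allFin d))

lastIdx : (d : ℕ) → 2 ≤ d → Fin d
lastIdx (suc m) _ = fromℕ m

-- With a t := x_{t+1} + 2^t − 1, the coordinate condition x = r(n) says exactly that
-- a t = ⌊(2^d − 1) n / 2^{D−t}⌋ for t ≤ D = d − 1. Such a family is a halving chain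
-- (a t = ⌊a (t+1) / 2⌋), which in terms of x is the condition φ(x_{i+1} + 1) = x_i, and a
-- halving chain is of this form precisely when 2^d − 1 divides its top a D. Along a
-- halving chain the bits ξ(x_{t+1} + 1) are the complements of the binary digits of a D
-- below a 0, so α = 2^D (1 + a 0) − 1 − a D, and the quantity in the congruence equals
-- 2^D M (1 + a 0) − (M + 1) a D with M = 2^d − 1 = 2^{D+1} − 1. It is divisible by 2^D M
-- iff M divides (M + 1) a D, i.e. iff M divides a D.
module Submission where

open import Defs
open import Data.Nat using (ℕ; zero; suc; _+_; _*_; _∸_; _^_; _≤_; _<_; z≤n; s≤s; s≤s⁻¹; z<s; NonZero)
import Data.Nat as N
open import Data.Nat.Properties
open import Data.Nat.DivMod
  using (_/_; _%_; /-congˡ; /-congʳ; m/n/o≡m/[n*o]; n/1≡n; m*n/n≡m; +-distrib-/-∣ʳ; [m+kn]%n≡m%n; m%n<n; m≡m%n+[m/n]*n)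
import Data.Nat.Divisibility as ℕ
open import Data.Nat.Tactic.RingSolver using (solve-∀)
open import Data.Fin using (Fin; toℕ; fromℕ)
import Data.Fin as Fin
open import Data.Fin.Properties using (toℕ<n; toℕ-fromℕ)
open import Data.List using (tabulate)
open import Data.List.Properties using (map-tabulate; tabulate-cong)
open import Data.Nat.ListAction using (sum)
open import Data.Integer using (+_; _-_)
import Data.Integer as ℤ
open import Data.Integer.Properties using (+-injective; neg-involutive)
import Data.Integer.Tactic.RingSolver as ℤ-Solver
open import Data.Integer.Divisibility using (_∣_)
import Data.Integer.Divisibility.Signed as Signed
open import Data.Empty using (⊥-elim)
open import Data.Product using (Σ; _×_; _,_)
open import Function using (id; _∘_)
open import Function.Bundles using (_⇔_; mk⇔; Equivalence)
open import Function.Construct.Composition using (_⇔-∘_)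
open import Relation.Binary.PropositionalEquality

open Equivalence using (to; from)

/2^-suc : ∀ m e → m /2^ suc e ≡ m /2^ e / 2
/2^-suc m e = begin
  m /2^ suc e     ≡⟨ /-congʳ (*-comm 2 (2 ^ e)) ⟩
  m / (2 ^ e * 2) ≡⟨ m/n/o≡m/[n*o] m (2 ^ e) 2 ⟨
  m /2^ e / 2     ∎
  where
  open ≡-Reasoning
  instance
    2^e≢0 : NonZero (2 ^ e)
    2^e≢0 = m^n≢0 2 e
    2^1+e≢0 : NonZero (2 ^ suc e)
    2^1+e≢0 = m^n≢0 2 (suc e)
    2^e*2≢0 : NonZero (2 ^ e * 2)
    2^e*2≢0 = m*n≢0 (2 ^ e) 2

[m+k*2]/2≡m/2+k : ∀ m k → (m + k * 2) / 2 ≡ m / 2 + k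
[m+k*2]/2≡m/2+k m k = trans (+-distrib-/-∣ʳ m (ℕ.divides-refl k)) (cong (λ z → m / 2 + z) (m*n/n≡m k 2))

Halving : ℕ → (ℕ → ℕ) → Set
Halving n a = ∀ t → t < n → a t ≡ a (suc t) / 2

halving⇒shifts : ∀ {n a} → Halving n a → ∀ t → t ≤ n → a t ≡ a n /2^ (n ∸ t)
halving⇒shifts {n} {a} halving t t≤n = shifts (n ∸ t) t (m+[n∸m]≡n t≤n)
  where
  open ≡-Reasoning
  shifts : ∀ j t → t + j ≡ n → a t ≡ a n /2^ j
  shifts zero t t+0≡n = trans (cong a (trans (sym (+-identityʳ t)) t+0≡n)) (sym (n/1≡n (a n)))
  shifts (suc j) t t+1+j≡n = begin
    a t           ≡⟨ halving t (subst (t <_) t+1+j≡n (m<m+n t z<s)) ⟩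
    a (suc t) / 2 ≡⟨ cong (_/ 2) (shifts j (suc t) (trans (sym (+-suc t j)) t+1+j≡n)) ⟩
    a n /2^ j / 2 ≡⟨ /2^-suc (a n) j ⟨
    a n /2^ suc j ∎

shifts⇒halving : ∀ {n a} m → (∀ t → t ≤ n → a t ≡ m /2^ (n ∸ t)) → Halving n a
shifts⇒halving {suc n} {a} m shifts t (s≤s t≤n) = begin
  a t               ≡⟨ shifts t (m≤n⇒m≤1+n t≤n) ⟩
  m /2^ (suc n ∸ t) ≡⟨ cong (m /2^_) (+-∸-assoc 1 t≤n) ⟩
  m /2^ suc (n ∸ t) ≡⟨ /2^-suc m (n ∸ t) ⟩
  m /2^ (n ∸ t) / 2 ≡⟨ cong (_/ 2) (shifts (suc t) (s≤s t≤n)) ⟨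
  a (suc t) / 2     ∎
  where open ≡-Reasoning

multiple-shifts⇔halving : ∀ {n a} m → 0 < a n →
  (Σ ℕ λ k → 1 ≤ k × (∀ t → t ≤ n → a t ≡ (m * k) /2^ (n ∸ t))) ⇔ (Halving n a × m ℕ.∣ a n)
multiple-shifts⇔halving {n} {a} m 0<aₙ = mk⇔
  (λ (k , _ , shifts) → shifts⇒halving (m * k) shifts , ℕ.divides k (trans (top shifts) (*-comm m k)))
  (λ (halving , ℕ.divides k aₙ≡k*m) → k , positive k aₙ≡k*m , λ t t≤n →
    trans (halving⇒shifts halving t t≤n) (cong (_/2^ (n ∸ t)) (trans aₙ≡k*m (*-comm k m))))
  where
  top : ∀ {k} → (∀ t → t ≤ n → a t ≡ (m * k) /2^ (n ∸ t)) → a n ≡ m * k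
  top {k} shifts = trans (shifts n ≤-refl) (trans (cong ((m * k) /2^_) (n∸n≡0 n)) (n/1≡n (m * k)))
  positive : ∀ k → a n ≡ k * m → 1 ≤ k
  positive zero aₙ≡0 = ⊥-elim (n≮n 0 (subst (0 <_) aₙ≡0 0<aₙ))
  positive (suc k) _ = s≤s z≤n

fromBits : (n : ℕ) → (ℕ → ℕ) → ℕ
fromBits n b = sum (tabulate {n = n} λ t → 2 ^ (n ∸ suc (toℕ t)) * b (toℕ t))

halving⇒fromBits : ∀ n a → Halving n a → fromBits n (λ t → a (suc t) % 2) + 2 ^ n * a 0 ≡ a n
halving⇒fromBits zero a _ = +-identityʳ (a 0)
halving⇒fromBits (suc n) a halving = begin
  2 ^ n * (a 1 % 2) + bits + 2 * 2 ^ n * a 0       ≡⟨ cong (λ z → 2 ^ n * (a 1 % 2) + bits + 2 * 2 ^ n * z) (halving 0 z<s) ⟩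
  2 ^ n * (a 1 % 2) + bits + 2 * 2 ^ n * (a 1 / 2) ≡⟨ regroup (2 ^ n) (a 1 % 2) bits (a 1 / 2) ⟩
  bits + 2 ^ n * (a 1 % 2 + a 1 / 2 * 2)           ≡⟨ cong (λ z → bits + 2 ^ n * z) (m≡m%n+[m/n]*n (a 1) 2) ⟨
  bits + 2 ^ n * a 1                               ≡⟨ halving⇒fromBits n (a ∘ suc) (λ t t<n → halving (suc t) (s≤s t<n)) ⟩
  a (suc n)                                        ∎
  where
  open ≡-Reasoning
  bits : ℕ
  bits = fromBits n (λ t → a (suc (suc t)) % 2)
  regroup : ∀ p r w q → p * r + w + 2 * p * q ≡ w + p * (r + q * 2)
  regroup = solve-∀

fromBits-complement : ∀ n (b c : ℕ → ℕ) → (∀ t → b t + c t ≡ 1) → suc (fromBits n b + fromBits n c) ≡ 2 ^ n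
fromBits-complement zero _ _ _ = refl
fromBits-complement (suc n) b c b+c≡1 = begin
  suc (2 ^ n * b 0 + B + (2 ^ n * c 0 + C)) ≡⟨ regroup (2 ^ n) (b 0) (c 0) B C ⟩
  2 ^ n * (b 0 + c 0) + suc (B + C)         ≡⟨ cong₂ (λ u v → 2 ^ n * u + v) (b+c≡1 0) rest ⟩
  2 ^ n * 1 + 2 ^ n                         ≡⟨ double (2 ^ n) ⟩
  2 * 2 ^ n                                 ∎
  where
  open ≡-Reasoning
  B C : ℕ
  B = fromBits n (b ∘ suc)
  C = fromBits n (c ∘ suc)
  rest : suc (B + C) ≡ 2 ^ n
  rest = fromBits-complement n (b ∘ suc) (c ∘ suc) (b+c≡1 ∘ suc)
  regroup : ∀ p u v w w' → suc (p * u + w + (p * v + w')) ≡ p * (u + v) + suc (w + w')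
  regroup = solve-∀
  double : ∀ p → p * 1 + p ≡ 2 * p
  double = solve-∀

ξ+%2≡1 : ∀ y → ξ y + y % 2 ≡ 1
ξ+%2≡1 y with y % 2 | m%n<n y 2
... | 0 | _ = refl
... | 1 | _ = refl
... | suc (suc _) | s≤s (s≤s ())

mersenne : ℕ → ℕ
mersenne n = 2 ^ n ∸ 1

suc-mersenne : ∀ n → suc (mersenne n) ≡ 2 ^ n
suc-mersenne n = m+[n∸m]≡n (m^n>0 2 n)

mersenne-suc : ∀ n → mersenne n + 2 ^ n ≡ mersenne (suc n)
mersenne-suc n = suc-injective (begin
  suc (mersenne n) + 2 ^ n ≡⟨ cong (_+ 2 ^ n) (suc-mersenne n) ⟩
  2 ^ n + 2 ^ n            ≡⟨ cong (λ z → 2 ^ n + z) (+-identityʳ (2 ^ n)) ⟨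
  2 ^ suc n                ≡⟨ suc-mersenne (suc n) ⟨
  suc (mersenne (suc n))   ∎)
  where open ≡-Reasoning

q*m∣[1+m]*a⇔m∣a : ∀ {m q a} → suc m ≡ 2 * q → (q * m) ℕ.∣ (suc m * a) ⇔ m ℕ.∣ a
q*m∣[1+m]*a⇔m∣a {m} {q} {a} 1+m≡2q = mk⇔
  (λ qm∣[1+m]a → ℕ.∣m+n∣m⇒∣n (subst (m ℕ.∣_) (+-comm a (m * a)) (ℕ.∣-trans (ℕ.n∣m*n q) qm∣[1+m]a)) (ℕ.m∣m*n a))
  (λ (ℕ.divides k a≡k*m) → ℕ.divides (k * 2) (begin
    suc m * a       ≡⟨ cong₂ _*_ 1+m≡2q a≡k*m ⟩
    2 * q * (k * m) ≡⟨ regroup q k m ⟩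
    k * 2 * (q * m) ∎))
  where
  open ≡-Reasoning
  regroup : ∀ q k m → 2 * q * (k * m) ≡ k * 2 * (q * m)
  regroup = solve-∀

+m≡[+o-+n]+1⇔m+n≡o+1 : ∀ m n o → (+ m ≡ (+ o - + n) ℤ.+ + 1) ⇔ (m + n ≡ o + 1)
+m≡[+o-+n]+1⇔m+n≡o+1 m n o = mk⇔
  (λ eq → +-injective (begin
    + m ℤ.+ + n                 ≡⟨ cong (ℤ._+ + n) eq ⟩
    (+ o - + n) ℤ.+ + 1 ℤ.+ + n ≡⟨ cancel (+ o) (+ n) ⟩
    + o ℤ.+ + 1                 ∎))
  (λ eq → begin
    + m                         ≡⟨ uncancel (+ m) (+ n) ⟩
    + m ℤ.+ + n - + n           ≡⟨ cong (λ z → + z - + n) eq ⟩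
    + o ℤ.+ + 1 - + n           ≡⟨ reassociate (+ o) (+ n) ⟩
    (+ o - + n) ℤ.+ + 1         ∎)
  where
  open ≡-Reasoning
  cancel : ∀ o n → (o - n) ℤ.+ + 1 ℤ.+ n ≡ o ℤ.+ + 1
  cancel = ℤ-Solver.solve-∀
  uncancel : ∀ m n → m ≡ m ℤ.+ n - n
  uncancel = ℤ-Solver.solve-∀
  reassociate : ∀ o n → o ℤ.+ + 1 - n ≡ (o - n) ℤ.+ + 1
  reassociate = ℤ-Solver.solve-∀

+m-[+o-+n]≡+p-+q : ∀ {m n o p q} → m + n + q ≡ p + o → + m - (+ o - + n) ≡ + p - + q
+m-[+o-+n]≡+p-+q {m} {n} {o} {p} {q} m+n+q≡p+o = begin
  + m - (+ o - + n)                 ≡⟨ expand (+ m) (+ n) (+ o) (+ q) ⟩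
  + m ℤ.+ + n ℤ.+ + q - + o - + q   ≡⟨ cong (λ z → + z - + o - + q) m+n+q≡p+o ⟩
  + p ℤ.+ + o - + o - + q           ≡⟨ contract (+ p) (+ o) (+ q) ⟩
  + p - + q                         ∎
  where
  open ≡-Reasoning
  expand : ∀ m n o q → m - (o - n) ≡ m ℤ.+ n ℤ.+ q - o - q
  expand = ℤ-Solver.solve-∀
  contract : ∀ p o q → p ℤ.+ o - o - q ≡ p - q
  contract = ℤ-Solver.solve-∀

+m∣+[m*n]-+o⇔m∣o : ∀ m n o → (+ m ∣ + (m * n) - + o) ⇔ (m ℕ.∣ o)
+m∣+[m*n]-+o⇔m∣o m n o = mk⇔
  (λ m∣mn-o → Signed.∣⇒∣ᵤ {i = + o} (subst (Signed._∣_ (+ m)) (neg-involutive (+ o))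
    (Signed.∣m⇒∣-m (Signed.∣m+n∣m⇒∣n {n = ℤ.- + o} (Signed.∣ᵤ⇒∣ m∣mn-o) m∣mn))))
  (λ m∣o → Signed.∣⇒∣ᵤ (Signed.∣m∣n⇒∣m-n m∣mn (Signed.∣ᵤ⇒∣ {i = + o} m∣o)))
  where
  m∣mn : + m Signed.∣ + (m * n)
  m∣mn = Signed.∣ᵤ⇒∣ (ℕ.m∣m*n n)

-- The congruence quantity along a halving chain a: B is the binary complement of α,
-- P = 2^D − 1, Q = 2^D and M = 2^{D+1} − 1.
α-residue : ∀ {α B P Q M a₀ a xD} → suc P ≡ Q → suc (α + B) ≡ Q → P + Q ≡ M →
  B + Q * a₀ ≡ a → xD + P ≡ a → + (α * M) - (+ xD - + Q) ≡ + (Q * M * suc a₀) - + (suc M * a)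
α-residue {α} {B} {_} {_} {_} {a₀} {_} {xD} refl refl refl refl xD+P≡a =
  +m-[+o-+n]≡+p-+q {α * M} {Q} {xD} {Q * M * suc a₀} {suc M * a} balance
  where
  open ≡-Reasoning
  P Q M a : ℕ
  P = α + B
  Q = suc P
  M = P + Q
  a = B + Q * a₀
  identity : ∀ α B a₀ → let P = α + B; Q = suc P; M = P + Q; a = B + Q * a₀ in
    α * M + Q + suc M * a + P ≡ Q * M * suc a₀ + a
  identity = solve-∀
  balance : α * M + Q + suc M * a ≡ Q * M * suc a₀ + xD
  balance = +-cancelʳ-≡ P _ _ (begin
    α * M + Q + suc M * a + P  ≡⟨ identity α B a₀ ⟩
    Q * M * suc a₀ + a         ≡⟨ cong (λ z → Q * M * suc a₀ + z) xD+P≡a ⟨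
    Q * M * suc a₀ + (xD + P)  ≡⟨ +-assoc (Q * M * suc a₀) xD P ⟨
    Q * M * suc a₀ + xD + P    ∎)

clamp : (n : ℕ) → ℕ → Fin (suc n)
clamp zero _ = Fin.zero
clamp (suc n) zero = Fin.zero
clamp (suc n) (suc t) = Fin.suc (clamp n t)

clamp-toℕ : ∀ n (i : Fin (suc n)) → clamp n (toℕ i) ≡ i
clamp-toℕ zero Fin.zero = refl
clamp-toℕ (suc n) Fin.zero = refl
clamp-toℕ (suc n) (Fin.suc i) = cong Fin.suc (clamp-toℕ n i)

toℕ-clamp : ∀ n t → t ≤ n → toℕ (clamp n t) ≡ t
toℕ-clamp zero zero _ = refl
toℕ-clamp (suc n) zero _ = refl
toℕ-clamp (suc n) (suc t) (s≤s t≤n) = cong suc (toℕ-clamp n t t≤n)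

∀Fin⇔∀≤ : ∀ n {P : ℕ → Set} → ((i : Fin (suc n)) → P (toℕ i)) ⇔ (∀ t → t ≤ n → P t)
∀Fin⇔∀≤ n {P} = mk⇔
  (λ h t t≤n → subst P (toℕ-clamp n t t≤n) (h (clamp n t)))
  (λ h i → h (toℕ i) (s≤s⁻¹ (toℕ<n i)))

module Coordinates (D : ℕ) (x : Fin (suc D) → ℕ) where

  -- x reindexed by ℕ (constant beyond D), so that chains can be stated over ℕ
  X : ℕ → ℕ
  X t = x (clamp D t)

  a : ℕ → ℕ
  a t = X t + mersenne t

  x≡X : ∀ i → x i ≡ X (toℕ i)
  x≡X i = cong x (sym (clamp-toℕ D i))

  a-suc : ∀ t → a (suc t) ≡ (X (suc t) + 1) + mersenne t * 2
  a-suc t = begin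
    X (suc t) + mersenne (suc t)                    ≡⟨ cong (λ z → X (suc t) + z) (mersenne-suc t) ⟨
    X (suc t) + (mersenne t + 2 ^ t)                ≡⟨ cong (λ z → X (suc t) + (mersenne t + z)) (suc-mersenne t) ⟨
    X (suc t) + (mersenne t + suc (mersenne t))     ≡⟨ regroup (X (suc t)) (mersenne t) ⟩
    (X (suc t) + 1) + mersenne t * 2                ∎
    where
    open ≡-Reasoning
    regroup : ∀ y p → y + (p + suc p) ≡ (y + 1) + p * 2
    regroup = solve-∀

  0<a[1+t] : ∀ t → 0 < a (suc t)
  0<a[1+t] t = subst (0 <_) (sym (a-suc t)) (≤-trans (m≤n+m 1 (X (suc t))) (m≤m+n _ _))

  Chain : Set
  Chain = (i j : Fin (suc D)) → toℕ i ≡ suc (toℕ j) → φ (x i + 1) ≡ x j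

  chain⇔halving : Chain ⇔ Halving D a
  chain⇔halving = mk⇔
    (λ chain t t<D → trans (cong (_+ mersenne t) (sym (chain-at chain t t<D))) (sym (a-half t)))
    (λ halving i j i≡1+j → begin
      φ (x i + 1)              ≡⟨ cong (λ z → φ (z + 1)) (x≡X i) ⟩
      φ (X (toℕ i) + 1)        ≡⟨ cong (λ z → φ (X z + 1)) i≡1+j ⟩
      φ (X (suc (toℕ j)) + 1)  ≡⟨ +-cancelʳ-≡ _ _ _ (trans (sym (a-half (toℕ j))) (sym (halving (toℕ j) (j<D i≡1+j)))) ⟩
      X (toℕ j)                ≡⟨ x≡X j ⟨
      x j                      ∎)
    where
    open ≡-Reasoning
    a-half : ∀ t → a (suc t) / 2 ≡ φ (X (suc t) + 1) + mersenne t
    a-half t = trans (/-congˡ (a-suc t)) ([m+k*2]/2≡m/2+k (X (suc t) + 1) (mersenne t))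
    chain-at : Chain → ∀ t → t < D → φ (X (suc t) + 1) ≡ X t
    chain-at chain t t<D = chain (clamp D (suc t)) (clamp D t)
      (trans (toℕ-clamp D (suc t) t<D) (cong suc (sym (toℕ-clamp D t (<⇒≤ t<D)))))
    j<D : ∀ {i j : Fin (suc D)} → toℕ i ≡ suc (toℕ j) → toℕ j < D
    j<D {i} i≡1+j = s≤s⁻¹ (subst (_< suc D) i≡1+j (toℕ<n i))

  shift : ℕ → ℕ → ℕ
  shift n t = (mersenne (suc D) * n) /2^ (D ∸ t)

  coordinate⇔ : ∀ n i → (+ x i ≡ r (suc D) n i) ⇔ (a (toℕ i) ≡ shift n (toℕ i))
  coordinate⇔ n i = mk⇔
      (λ e → +-cancelʳ-≡ 1 _ _ (trans (sym x+2^≡a+1) e))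
      (λ e → trans x+2^≡a+1 (cong (_+ 1) e))
    ⇔-∘ +m≡[+o-+n]+1⇔m+n≡o+1 (x i) (2 ^ toℕ i) (shift n (toℕ i))
    where
    x+2^≡a+1 : x i + 2 ^ toℕ i ≡ a (toℕ i) + 1
    x+2^≡a+1 = begin
      x i + 2 ^ toℕ i                    ≡⟨ cong (_+ 2 ^ toℕ i) (x≡X i) ⟩
      X (toℕ i) + 2 ^ toℕ i              ≡⟨ cong (λ z → X (toℕ i) + z) (suc-mersenne (toℕ i)) ⟨
      X (toℕ i) + suc (mersenne (toℕ i)) ≡⟨ +-suc (X (toℕ i)) _ ⟩
      suc (a (toℕ i))                    ≡⟨ +-comm 1 (a (toℕ i)) ⟩
      a (toℕ i) + 1                      ∎
      where open ≡-Reasoning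

  coordinates⇔ : ∀ n → (∀ i → + x i ≡ r (suc D) n i) ⇔ (∀ t → t ≤ D → a t ≡ shift n t)
  coordinates⇔ n = ∀Fin⇔∀≤ D ⇔-∘
    mk⇔ (λ h i → to (coordinate⇔ n i) (h i)) (λ h i → from (coordinate⇔ n i) (h i))

  α≡fromBits : α (suc D) x ≡ fromBits D (λ t → ξ (X (suc t) + 1))
  α≡fromBits = trans (cong sum (map-tabulate id (αterm (suc D) x)))
    (cong sum (tabulate-cong {n = D} λ j → cong (λ z → 2 ^ (D ∸ suc (toℕ j)) * ξ (z + 1)) (x≡X (Fin.suc j))))

  residue : Halving D a →
    + (α (suc D) x * mersenne (suc D)) - (+ x (fromℕ D) - + (2 ^ D))
      ≡ + (2 ^ D * mersenne (suc D) * suc (a 0)) - + (suc (mersenne (suc D)) * a D)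
  residue halving = α-residue (suc-mersenne D) complement (mersenne-suc D)
    (halving⇒fromBits D a halving) (cong (_+ mersenne D) x-last)
    where
    digit-complement : ∀ t → ξ (X (suc t) + 1) + a (suc t) % 2 ≡ 1
    digit-complement t = trans
      (cong (λ z → ξ (X (suc t) + 1) + z) (trans (cong (_% 2) (a-suc t)) ([m+kn]%n≡m%n (X (suc t) + 1) (mersenne t) 2)))
      (ξ+%2≡1 (X (suc t) + 1))
    complement : suc (α (suc D) x + fromBits D (λ t → a (suc t) % 2)) ≡ 2 ^ D
    complement = trans (cong (λ z → suc (z + fromBits D (λ t → a (suc t) % 2))) α≡fromBits)
      (fromBits-complement D (λ t → ξ (X (suc t) + 1)) (λ t → a (suc t) % 2) digit-complement)
    x-last : x (fromℕ D) ≡ X D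
    x-last = trans (x≡X (fromℕ D)) (cong X (toℕ-fromℕ D))

  divisibility⇔ : Halving D a →
    (+ (2 ^ D * mersenne (suc D)) ∣ + (α (suc D) x * mersenne (suc D)) - (+ x (fromℕ D) - + (2 ^ D)))
      ⇔ (mersenne (suc D) ℕ.∣ a D)
  divisibility⇔ halving rewrite residue halving =
    q*m∣[1+m]*a⇔m∣a {q = 2 ^ D} (suc-mersenne (suc D))
      ⇔-∘ +m∣+[m*n]-+o⇔m∣o (2 ^ D * mersenne (suc D)) (suc (a 0)) (suc (mersenne (suc D)) * a D)

proposition1 : (d : ℕ) → (hd : 2 ≤ d) → (x : Fin d → ℕ) →
    (Σ ℕ (λ n → (1 ≤ n) × ((i : Fin d) → + (x i) ≡ r d n i)))
    ⇔ (((i j : Fin d) → toℕ i ≡ suc (toℕ j) → φ (x i N.+ 1) ≡ x j)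
       × ((+ (2 ^ (d ∸ 1) * (2 ^ d ∸ 1))) ∣ ((+ (α d x * (2 ^ d ∸ 1))) - ((+ (x (lastIdx d hd))) - (+ (2 ^ (d ∸ 1)))))))
proposition1 zero () x
proposition1 (suc zero) (s≤s ()) x
proposition1 (suc (suc k)) _ x = mk⇔
  (λ (n , 1≤n , x≡r) →
    let halving , M∣aD = to shifts⇔ (n , 1≤n , to (coordinates⇔ n) x≡r)
    in from chain⇔halving halving , from (divisibility⇔ halving) M∣aD)
  (λ (chain , divisible) →
    let halving = to chain⇔halving chain
        n , 1≤n , shifts = from shifts⇔ (halving , to (divisibility⇔ halving) divisible)
    in n , 1≤n , from (coordinates⇔ n) shifts)
  where
  open Coordinates (suc k) x
  shifts⇔ : (Σ ℕ λ n → 1 ≤ n × (∀ t → t ≤ suc k → a t ≡ shift n t))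
              ⇔ (Halving (suc k) a × mersenne (suc (suc k)) ℕ.∣ a (suc k))
  shifts⇔ = multiple-shifts⇔halving (mersenne (suc (suc k))) (0<a[1+t] k)
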